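{- Let $n$ be a non-negative integer and $s$ any integer. Then \[ \sum_{j = 0}^n \frac{F_{3j + s - n}}{\binom nj} = \frac{n + 1}{2^{n + 1}}\sum_{j = 0}^n \frac{2^j}{j + 1}(F_{s + 2j + 1} + F_{s - j - 2}), \qquad \sum_{j = 0}^n \frac{L_{3j + s - n}}{\binom nj} = \frac{n + 1}{2^{n + 1}}\sum_{j = 0}^n \frac{2^j}{j + 1}(L_{s + 2j + 1} + L_{s - j - 2}), \] \[ \sum_{j = 0}^n \frac{( - 1)^j F_{3j + s - 2n}}{\binom nj} = \frac{n + 1}{2^{n + 1}}\sum_{j = 0}^n \frac{2^j ( - 1)^j}{j + 1}\left(F_{s + j + 2} + ( - 1)^{j - 1} F_{s - 2j - 1}\right), \] \[ \sum_{j = 0}^n \frac{( - 1)^j L_{3j + s - 2n}}{\binom nj} = \frac{n + 1}{2^{n + 1}}\sum_{j = 0}^n \frac{2^j ( - 1)^j}{j + 1}\left(L_{s + j + 2} + ( - 1)^{j - 1} L_{s - 2j - 1}\right). \]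
   Context: $F_j$ and $L_j$ denote the Fibonacci and Lucas numbers, defined for all integers $j$ by $F_0=0$, $F_1=1$, $L_0=2$, $L_1=1$, $F_j=F_{j-1}+F_{j-2}$, $L_j=L_{j-1}+L_{j-2}$, extended to negative indices by $F_{ -j}=(-1)^{j-1}F_j$, $L_{ -j}=(-1)^jL_j$; equivalently $F_j=(\alpha^j-\beta^j)/\sqrt5$, $L_j=\alpha^j+\beta^j$ with $\alpha=(1+\sqrt5)/2$, $\beta=(1-\sqrt5)/2$. -}

module Defs where

open import Data.Nat as ℕ using (ℕ; zero; suc)
open import Data.Nat.Combinatorics using (_C_)
open import Data.Integer as ℤ using (ℤ; +_; -[1+_])
open import Data.Rational as ℚ using (ℚ)

fibℕ : ℕ → ℕ
fibℕ zero = 0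
fibℕ (suc zero) = 1
fibℕ (suc (suc n)) = fibℕ (suc n) ℕ.+ fibℕ n

lucℕ : ℕ → ℕ
lucℕ zero = 2
lucℕ (suc zero) = 1
lucℕ (suc (suc n)) = lucℕ (suc n) ℕ.+ lucℕ n

sgn : ℕ → ℤ
sgn zero = + 1
sgn (suc k) = ℤ.- sgn k

-- Extension to all integers: F_{-m} = (-1)^{m-1} F_m, L_{-m} = (-1)^m L_m
F : ℤ → ℤ
F (+ m) = + fibℕ m
F -[1+ k ] = sgn k ℤ.* + fibℕ (suc k)        -- m = k+1, (-1)^(m-1) = (-1)^k

L : ℤ → ℤ
L (+ m) = + lucℕ m
L -[1+ k ] = sgn (suc k) ℤ.* + lucℕ (suc k)

sumTo : ℕ → (ℕ → ℚ) → ℚ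
sumTo zero f = f 0
sumTo (suc n) f = sumTo n f ℚ.+ f (suc n)

-- integer divided by a natural number (only used with nonzero divisors;
-- the value at divisor 0 is irrelevant and set to 0)
_/ℕ_ : ℤ → ℕ → ℚ
x /ℕ zero = ℚ.0ℚ
x /ℕ suc d = x ℚ./ suc d

ι : ℕ → ℤ
ι = +_

{-# OPTIONS --safe #-}
module Submission where

-- Write aₙ(k) for the numerator in row n (e.g. F(3k+s−n)) and Sₙ = Σₖ aₙ(k)/C(n,k).
-- In all four identities the recurrence of F and L makes every entry of row n+1 the
-- average of two neighbours in row n: aₙ(k−1) + aₙ(k) = 2aₙ₊₁(k).  Splitting 2Sₙ₊₁
-- accordingly and applying the reciprocal Pascal rule
--   1/C(n+1,k) + 1/C(n+1,k+1) = (n+2)/((n+1)·C(n,k))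
-- gives the first-order recurrence 2Sₙ₊₁ = (n+2)/(n+1)·Sₙ + aₙ(n+1) + aₙ(−1), whose
-- solution is (n+1)/2ⁿ⁺¹ · Σⱼ 2ʲ/(j+1)·eⱼ with e₀ = 2a₀(0) and eⱼ₊₁ = aⱼ(j+1) + aⱼ(−1).

open import Defs
open import Data.Product using (_×_; _,_)
open import Data.Maybe using (nothing)
open import Level using (0ℓ)
open import Data.Nat as ℕ using (ℕ; zero; suc; _≤_; _<_; z≤n; s≤s; NonZero)
import Data.Nat.Properties as ℕP
open import Data.Nat.Combinatorics using (_C_; nCk+nC[k+1]≡[n+1]C[k+1]; k>n⇒nCk≡0; nC1≡n; nCn≡1)
open import Data.Integer as ℤ using (ℤ; +_; -[1+_])
import Data.Integer.Properties as ℤP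
open import Data.Rational as ℚ using (ℚ; _+_; _*_; toℚᵘ)
import Data.Rational.Properties as ℚP
import Data.Rational.Unnormalised as ℚᵘ
import Data.Rational.Unnormalised.Properties as ℚᵘP
open import Relation.Binary.PropositionalEquality
open import Function using (_∘_)
import Data.Nat.Tactic.RingSolver as ℕ-Solver
import Data.Integer.Tactic.RingSolver as ℤ-Solver
import Tactic.RingSolver as RingSolver
import Tactic.RingSolver.Core.AlmostCommutativeRing as ACR
open import Algebra.Bundles using (CommutativeMonoid)
import Algebra.Properties.CommutativeSemigroup as CommSemigroupProperties

ℚ-ring : ACR.AlmostCommutativeRing 0ℓ 0ℓ
ℚ-ring = ACR.fromCommutativeRing ℚP.+-*-commutativeRing (λ _ → nothing)

toℚᵘ-/ℕ : ∀ x d .{{_ : NonZero d}} → toℚᵘ (x /ℕ d) ℚᵘ.≃ x ℚᵘ./ d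
toℚᵘ-/ℕ x (suc d) = ℚP.toℚᵘ-fromℚᵘ (ℚᵘ.mkℚᵘ x d)

/ℕ-cross : ∀ x y d e .{{_ : NonZero d}} .{{_ : NonZero e}} →
           x ℤ.* + e ≡ y ℤ.* + d → x /ℕ d ≡ y /ℕ e
/ℕ-cross x y d@(suc _) e@(suc _) eq = ℚP.toℚᵘ-injective
  (ℚᵘP.≃-trans (toℚᵘ-/ℕ x d) (ℚᵘP.≃-trans (ℚᵘ.*≡* eq) (ℚᵘP.≃-sym (toℚᵘ-/ℕ y e))))

/ℕ-* : ∀ x y d e .{{_ : NonZero d}} .{{_ : NonZero e}} →
       (x /ℕ d) * (y /ℕ e) ≡ (x ℤ.* y) /ℕ (d ℕ.* e)
/ℕ-* x y d@(suc _) e@(suc _) = ℚP.toℚᵘ-injective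
  (ℚᵘP.≃-trans (ℚP.toℚᵘ-homo-* (x /ℕ d) (y /ℕ e))
  (ℚᵘP.≃-trans (ℚᵘP.*-cong (toℚᵘ-/ℕ x d) (toℚᵘ-/ℕ y e)) (ℚᵘP.≃-sym (toℚᵘ-/ℕ (x ℤ.* y) (d ℕ.* e)))))

/ℕ-+ : ∀ x y d e .{{_ : NonZero d}} .{{_ : NonZero e}} →
       x /ℕ d + y /ℕ e ≡ (x ℤ.* + e ℤ.+ y ℤ.* + d) /ℕ (d ℕ.* e)
/ℕ-+ x y d@(suc _) e@(suc _) = ℚP.toℚᵘ-injective
  (ℚᵘP.≃-trans (ℚP.toℚᵘ-homo-+ (x /ℕ d) (y /ℕ e))
  (ℚᵘP.≃-trans (ℚᵘP.+-cong (toℚᵘ-/ℕ x d) (toℚᵘ-/ℕ y e)) (ℚᵘP.≃-sym (toℚᵘ-/ℕ _ (d ℕ.* e)))))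

/ℕ-distribʳ-+ : ∀ x y d → (x ℤ.+ y) /ℕ d ≡ x /ℕ d + y /ℕ d
/ℕ-distribʳ-+ x y zero = refl
/ℕ-distribʳ-+ x y d@(suc _) = sym (trans (/ℕ-+ x y d d) (/ℕ-cross (x ℤ.* + d ℤ.+ y ℤ.* + d) (x ℤ.+ y) (d ℕ.* d) d eq))
  where
  eq : (x ℤ.* + d ℤ.+ y ℤ.* + d) ℤ.* + d ≡ (x ℤ.+ y) ℤ.* + (d ℕ.* d)
  eq = begin
    (x ℤ.* + d ℤ.+ y ℤ.* + d) ℤ.* + d ≡⟨ cong (ℤ._* + d) (ℤP.*-distribʳ-+ (+ d) x y) ⟨
    (x ℤ.+ y) ℤ.* + d ℤ.* + d         ≡⟨ ℤP.*-assoc (x ℤ.+ y) (+ d) (+ d) ⟩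
    (x ℤ.+ y) ℤ.* (+ d ℤ.* + d)       ≡⟨ cong ((x ℤ.+ y) ℤ.*_) (ℤP.pos-* d d) ⟨
    (x ℤ.+ y) ℤ.* + (d ℕ.* d)         ∎
    where open ≡-Reasoning

/ℕ-cancel : ∀ x b c .{{_ : NonZero b}} .{{_ : NonZero c}} → (x /ℕ b) * ((+ b) /ℕ c) ≡ x /ℕ c
/ℕ-cancel x b@(suc _) c@(suc _) = trans (/ℕ-* x (+ b) b c) (/ℕ-cross (x ℤ.* + b) x (b ℕ.* c) c eq)
  where
  eq : (x ℤ.* + b) ℤ.* + c ≡ x ℤ.* + (b ℕ.* c)
  eq = trans (ℤP.*-assoc x (+ b) (+ c)) (cong (x ℤ.*_) (sym (ℤP.pos-* b c)))

/ℕ-*-moveˡ : ∀ x y z d e .{{_ : NonZero d}} .{{_ : NonZero e}} →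
             (x /ℕ d) * ((y ℤ.* z) /ℕ e) ≡ ((y ℤ.* x) /ℕ d) * (z /ℕ e)
/ℕ-*-moveˡ x y z d e = begin
  (x /ℕ d) * ((y ℤ.* z) /ℕ e)        ≡⟨ /ℕ-* x (y ℤ.* z) d e ⟩
  (x ℤ.* (y ℤ.* z)) /ℕ (d ℕ.* e)     ≡⟨ cong (_/ℕ (d ℕ.* e)) (ℤP.*-assoc x y z) ⟨
  (x ℤ.* y ℤ.* z) /ℕ (d ℕ.* e)       ≡⟨ cong (λ w → (w ℤ.* z) /ℕ (d ℕ.* e)) (ℤP.*-comm x y) ⟩
  (y ℤ.* x ℤ.* z) /ℕ (d ℕ.* e)       ≡⟨ /ℕ-* (y ℤ.* x) z d e ⟨
  ((y ℤ.* x) /ℕ d) * (z /ℕ e)        ∎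
  where open ≡-Reasoning

sumTo-cong : ∀ n {f g : ℕ → ℚ} → (∀ {k} → k ≤ n → f k ≡ g k) → sumTo n f ≡ sumTo n g
sumTo-cong zero    f≗g = f≗g z≤n
sumTo-cong (suc n) f≗g = cong₂ _+_ (sumTo-cong n (f≗g ∘ ℕP.m≤n⇒m≤1+n)) (f≗g ℕP.≤-refl)

sumTo-distrib-+ : ∀ n (f g : ℕ → ℚ) → sumTo n (λ k → f k + g k) ≡ sumTo n f + sumTo n g
sumTo-distrib-+ zero    f g = refl
sumTo-distrib-+ (suc n) f g = trans (cong (_+ (f (suc n) + g (suc n))) (sumTo-distrib-+ n f g))
  (+-interchange (sumTo n f) (sumTo n g) (f (suc n)) (g (suc n)))
  where open CommSemigroupProperties (CommutativeMonoid.commutativeSemigroup ℚP.+-0-commutativeMonoid)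
          renaming (interchange to +-interchange)

*-distribˡ-sumTo : ∀ c n (f : ℕ → ℚ) → c * sumTo n f ≡ sumTo n (λ k → c * f k)
*-distribˡ-sumTo c zero    f = refl
*-distribˡ-sumTo c (suc n) f = trans (ℚP.*-distribˡ-+ c (sumTo n f) (f (suc n)))
  (cong (_+ c * f (suc n)) (*-distribˡ-sumTo c n f))

sumTo-suc : ∀ n (f : ℕ → ℚ) → sumTo (suc n) f ≡ f 0 + sumTo n (f ∘ suc)
sumTo-suc zero    f = refl
sumTo-suc (suc n) f = trans (cong (_+ f (suc (suc n))) (sumTo-suc n f)) (ℚP.+-assoc (f 0) _ _)

k≤n⇒nCk>0 : ∀ {n k} → k ≤ n → 0 < n C k
k≤n⇒nCk>0 {n}     {zero}  _         = s≤s z≤n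
k≤n⇒nCk>0 {suc n} {suc k} (s≤s k≤n) = subst (0 <_) (nCk+nC[k+1]≡[n+1]C[k+1] n k)
  (ℕP.<-≤-trans (k≤n⇒nCk>0 k≤n) (ℕP.m≤m+n (n C k) (n C suc k)))

[k+1]*[n+1]C[k+1]≡[n+1]*nCk : ∀ n k → suc k ℕ.* (suc n C suc k) ≡ suc n ℕ.* (n C k)
[k+1]*[n+1]C[k+1]≡[n+1]*nCk zero zero = refl
[k+1]*[n+1]C[k+1]≡[n+1]*nCk zero (suc k)
  rewrite k>n⇒nCk≡0 {1} {suc (suc k)} (s≤s (s≤s z≤n)) | k>n⇒nCk≡0 {0} {suc k} (s≤s z≤n)
  = ℕP.*-zeroʳ (suc (suc k))
[k+1]*[n+1]C[k+1]≡[n+1]*nCk (suc n) zero =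
  trans (ℕP.*-identityˡ _) (trans (nC1≡n (suc (suc n))) (sym (ℕP.*-identityʳ _)))
[k+1]*[n+1]C[k+1]≡[n+1]*nCk (suc n) (suc k) = begin
  suc (suc k) ℕ.* (suc (suc n) C suc (suc k))             ≡⟨ cong (suc (suc k) ℕ.*_) (nCk+nC[k+1]≡[n+1]C[k+1] (suc n) (suc k)) ⟨
  suc (suc k) ℕ.* (A ℕ.+ B)                               ≡⟨ split k A B ⟩
  A ℕ.+ (suc k ℕ.* A ℕ.+ suc (suc k) ℕ.* B)               ≡⟨ cong (A ℕ.+_) (cong₂ ℕ._+_ ([k+1]*[n+1]C[k+1]≡[n+1]*nCk n k) ([k+1]*[n+1]C[k+1]≡[n+1]*nCk n (suc k))) ⟩
  A ℕ.+ (suc n ℕ.* (n C k) ℕ.+ suc n ℕ.* (n C suc k))     ≡⟨ cong (A ℕ.+_) (ℕP.*-distribˡ-+ (suc n) (n C k) (n C suc k)) ⟨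
  A ℕ.+ suc n ℕ.* (n C k ℕ.+ n C suc k)                   ≡⟨ cong (λ m → A ℕ.+ suc n ℕ.* m) (nCk+nC[k+1]≡[n+1]C[k+1] n k) ⟩
  suc (suc n) ℕ.* A                                       ∎
  where
  open ≡-Reasoning
  A = suc n C suc k
  B = suc n C suc (suc k)
  split : ∀ k a b → suc (suc k) ℕ.* (a ℕ.+ b) ≡ a ℕ.+ (suc k ℕ.* a ℕ.+ suc (suc k) ℕ.* b)
  split = ℕ-Solver.solve-∀

reciprocal-pascal-cross : ∀ n k →
  (suc n C suc k ℕ.+ suc n C k) ℕ.* (suc n ℕ.* (n C k)) ≡ suc (suc n) ℕ.* ((suc n C k) ℕ.* (suc n C suc k))
reciprocal-pascal-cross n k = begin
  (B ℕ.+ A) ℕ.* (suc n ℕ.* (n C k))  ≡⟨ cong ((B ℕ.+ A) ℕ.*_) ([k+1]*[n+1]C[k+1]≡[n+1]*nCk n k) ⟨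
  (B ℕ.+ A) ℕ.* (suc k ℕ.* B)        ≡⟨ regroup A B (suc k) ⟩
  (suc k ℕ.* (A ℕ.+ B)) ℕ.* B        ≡⟨ cong (λ m → suc k ℕ.* m ℕ.* B) (nCk+nC[k+1]≡[n+1]C[k+1] (suc n) k) ⟩
  (suc k ℕ.* (suc (suc n) C suc k)) ℕ.* B ≡⟨ cong (ℕ._* B) ([k+1]*[n+1]C[k+1]≡[n+1]*nCk (suc n) k) ⟩
  suc (suc n) ℕ.* A ℕ.* B            ≡⟨ ℕP.*-assoc (suc (suc n)) A B ⟩
  suc (suc n) ℕ.* (A ℕ.* B)          ∎
  where
  open ≡-Reasoning
  A = suc n C k
  B = suc n C suc k
  regroup : ∀ a b k → (b ℕ.+ a) ℕ.* (k ℕ.* b) ≡ (k ℕ.* (a ℕ.+ b)) ℕ.* b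
  regroup = ℕ-Solver.solve-∀

reciprocal-pascal : ∀ x {n k} → k ≤ n →
  x /ℕ (suc n C k) + x /ℕ (suc n C suc k) ≡ ((+ suc (suc n)) /ℕ suc n) * (x /ℕ (n C k))
reciprocal-pascal x {n} {k} k≤n = begin
  x /ℕ A + x /ℕ B                         ≡⟨ /ℕ-+ x x A B ⟩
  (x ℤ.* + B ℤ.+ x ℤ.* + A) /ℕ (A ℕ.* B)  ≡⟨ /ℕ-cross _ (+ suc (suc n) ℤ.* x) (A ℕ.* B) (suc n ℕ.* c) cross ⟩
  (+ suc (suc n) ℤ.* x) /ℕ (suc n ℕ.* c)  ≡⟨ /ℕ-* (+ suc (suc n)) x (suc n) c ⟨
  ((+ suc (suc n)) /ℕ suc n) * (x /ℕ c)   ∎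
  where
  open ≡-Reasoning
  A = suc n C k
  B = suc n C suc k
  c = n C k
  instance
    A≢0 = ℕ.>-nonZero (k≤n⇒nCk>0 (ℕP.m≤n⇒m≤1+n k≤n))
    B≢0 = ℕ.>-nonZero (k≤n⇒nCk>0 (s≤s k≤n))
    c≢0 = ℕ.>-nonZero (k≤n⇒nCk>0 k≤n)
    AB≢0 = ℕP.m*n≢0 A B
    [n+1]c≢0 = ℕP.m*n≢0 (suc n) c
  factor : ∀ x b a m → (x ℤ.* b ℤ.+ x ℤ.* a) ℤ.* m ≡ x ℤ.* ((b ℤ.+ a) ℤ.* m)
  factor = ℤ-Solver.solve-∀
  regroup : ∀ x p q → x ℤ.* (p ℤ.* q) ≡ (p ℤ.* x) ℤ.* q
  regroup = ℤ-Solver.solve-∀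
  cross : (x ℤ.* + B ℤ.+ x ℤ.* + A) ℤ.* + (suc n ℕ.* c) ≡ (+ suc (suc n) ℤ.* x) ℤ.* + (A ℕ.* B)
  cross = begin
    (x ℤ.* + B ℤ.+ x ℤ.* + A) ℤ.* + (suc n ℕ.* c)   ≡⟨ factor x (+ B) (+ A) (+ (suc n ℕ.* c)) ⟩
    x ℤ.* ((+ B ℤ.+ + A) ℤ.* + (suc n ℕ.* c))        ≡⟨ cong (x ℤ.*_) (trans (ℤP.pos-* (B ℕ.+ A) (suc n ℕ.* c)) (cong (ℤ._* + (suc n ℕ.* c)) (ℤP.pos-+ B A))) ⟨
    x ℤ.* + ((B ℕ.+ A) ℕ.* (suc n ℕ.* c))           ≡⟨ cong (λ m → x ℤ.* + m) (reciprocal-pascal-cross n k) ⟩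
    x ℤ.* + (suc (suc n) ℕ.* (A ℕ.* B))             ≡⟨ cong (x ℤ.*_) (ℤP.pos-* (suc (suc n)) (A ℕ.* B)) ⟩
    x ℤ.* (+ suc (suc n) ℤ.* + (A ℕ.* B))           ≡⟨ regroup x (+ suc (suc n)) (+ (A ℕ.* B)) ⟩
    (+ suc (suc n) ℤ.* x) ℤ.* + (A ℕ.* B)           ∎

½*[p+p]≡p : ∀ p → ((+ 1) /ℕ 2) * (p + p) ≡ p
½*[p+p]≡p p = begin
  ½ * (p + p)     ≡⟨ ℚP.*-distribˡ-+ ½ p p ⟩
  ½ * p + ½ * p   ≡⟨ ℚP.*-distribʳ-+ p ½ ½ ⟨
  (½ + ½) * p     ≡⟨ ℚP.*-identityˡ p ⟩
  p               ∎
  where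
  open ≡-Reasoning
  ½ = (+ 1) /ℕ 2

½*[x/d]≡x/[2*d] : ∀ x d .{{_ : NonZero d}} → ((+ 1) /ℕ 2) * (x /ℕ d) ≡ x /ℕ (2 ℕ.* d)
½*[x/d]≡x/[2*d] x d = trans (/ℕ-* (+ 1) x 2 d) (cong (_/ℕ (2 ℕ.* d)) (ℤP.*-identityˡ x))

m/[2*m]≡½ : ∀ m .{{_ : NonZero m}} → (+ m) /ℕ (2 ℕ.* m) ≡ (+ 1) /ℕ 2
m/[2*m]≡½ m = /ℕ-cross (+ m) (+ 1) (2 ℕ.* m) 2 (begin
  + m ℤ.* + 2          ≡⟨ ℤP.*-comm (+ m) (+ 2) ⟩
  + 2 ℤ.* + m          ≡⟨ ℤP.pos-* 2 m ⟨
  + (2 ℕ.* m)          ≡⟨ ℤP.*-identityˡ (+ (2 ℕ.* m)) ⟨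
  + 1 ℤ.* + (2 ℕ.* m)  ∎)
  where
  open ≡-Reasoning
  instance
    2m≢0 = ℕP.m*n≢0 2 m

module Averaging (a : ℕ → ℤ → ℤ)
                 (average : ∀ n k → a n (k ℤ.- + 1) ℤ.+ a n k ≡ a (suc n) k ℤ.+ a (suc n) k) where

  reciprocalSum : ℕ → ℚ
  reciprocalSum n = sumTo n (λ k → a n (+ k) /ℕ (n C k))

  reciprocalSum-rec : ∀ n → reciprocalSum (suc n) + reciprocalSum (suc n)
    ≡ ((+ suc (suc n)) /ℕ suc n) * reciprocalSum n + (a n (+ suc n) ℤ.+ a n ℤ.-1ℤ) /ℕ 1
  reciprocalSum-rec n = begin
    sumTo (suc n) f + sumTo (suc n) f          ≡⟨ sumTo-distrib-+ (suc n) f f ⟨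
    sumTo (suc n) (λ k → f k + f k)            ≡⟨ sumTo-cong (suc n) (λ {k} _ → split k) ⟩
    sumTo (suc n) (λ k → g k + h k)            ≡⟨ sumTo-distrib-+ (suc n) g h ⟩
    sumTo (suc n) g + sumTo (suc n) h          ≡⟨ cong₂ _+_ (sumTo-suc n g) (cong (λ m → sumTo n h + a n (+ suc n) /ℕ m) (nCn≡1 (suc n))) ⟩
    (left + sumTo n (g ∘ suc)) + (sumTo n h + right) ≡⟨ rearrange left (sumTo n (g ∘ suc)) (sumTo n h) right ⟩
    (sumTo n h + sumTo n (g ∘ suc)) + (right + left) ≡⟨ cong₂ _+_ (sumTo-distrib-+ n h (g ∘ suc)) (/ℕ-distribʳ-+ (a n (+ suc n)) (a n ℤ.-1ℤ) 1) ⟨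
    sumTo n (λ k → h k + g (suc k)) + ends      ≡⟨ cong (_+ ends) (sumTo-cong n (reciprocal-pascal (a n (+ _)))) ⟩
    sumTo n (λ k → r * (a n (+ k) /ℕ (n C k))) + ends ≡⟨ cong (_+ ends) (*-distribˡ-sumTo r n (λ k → a n (+ k) /ℕ (n C k))) ⟨
    r * reciprocalSum n + ends                 ∎
    where
    open ≡-Reasoning
    r = (+ suc (suc n)) /ℕ suc n
    left = a n ℤ.-1ℤ /ℕ 1
    right = a n (+ suc n) /ℕ 1
    ends = (a n (+ suc n) ℤ.+ a n ℤ.-1ℤ) /ℕ 1
    f g h : ℕ → ℚ
    f k = a (suc n) (+ k) /ℕ (suc n C k)
    g k = a n (+ k ℤ.- + 1) /ℕ (suc n C k)
    h k = a n (+ k) /ℕ (suc n C k)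
    split : ∀ k → f k + f k ≡ g k + h k
    split k = begin
      f k + f k
        ≡⟨ /ℕ-distribʳ-+ (a (suc n) (+ k)) (a (suc n) (+ k)) (suc n C k) ⟨
      (a (suc n) (+ k) ℤ.+ a (suc n) (+ k)) /ℕ (suc n C k)
        ≡⟨ cong (_/ℕ (suc n C k)) (average n (+ k)) ⟨
      (a n (+ k ℤ.- + 1) ℤ.+ a n (+ k)) /ℕ (suc n C k)
        ≡⟨ /ℕ-distribʳ-+ (a n (+ k ℤ.- + 1)) (a n (+ k)) (suc n C k) ⟩
      g k + h k
        ∎
    rearrange : ∀ u x y v → (u + x) + (y + v) ≡ (y + x) + (v + u)
    rearrange = RingSolver.solve-∀ ℚ-ring

  module _ (e : ℕ → ℤ) (e-zero : e 0 ≡ a 0 (+ 0) ℤ.+ a 0 (+ 0))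
           (e-suc : ∀ j → e (suc j) ≡ a j (+ suc j) ℤ.+ a j ℤ.-1ℤ) where

    reciprocalSum-closed : ∀ n → reciprocalSum n
      ≡ ((+ suc n) /ℕ (2 ℕ.^ suc n)) * sumTo n (λ j → ((+ (2 ℕ.^ j)) /ℕ suc j) * (e j /ℕ 1))
    reciprocalSum-closed zero = begin
      a 0 (+ 0) /ℕ 1                                ≡⟨ ½*[p+p]≡p (a 0 (+ 0) /ℕ 1) ⟨
      ½ * (a 0 (+ 0) /ℕ 1 + a 0 (+ 0) /ℕ 1)          ≡⟨ cong (½ *_) (/ℕ-distribʳ-+ (a 0 (+ 0)) (a 0 (+ 0)) 1) ⟨
      ½ * ((a 0 (+ 0) ℤ.+ a 0 (+ 0)) /ℕ 1)           ≡⟨ cong (λ x → ½ * (x /ℕ 1)) e-zero ⟨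
      ½ * (e 0 /ℕ 1)                                ≡⟨ cong (½ *_) (ℚP.*-identityˡ (e 0 /ℕ 1)) ⟨
      ½ * (((+ 1) /ℕ 1) * (e 0 /ℕ 1))                ∎
      where
      open ≡-Reasoning
      ½ = (+ 1) /ℕ 2
    reciprocalSum-closed (suc n) = begin
      reciprocalSum (suc n)                         ≡⟨ ½*[p+p]≡p (reciprocalSum (suc n)) ⟨
      ½ * (reciprocalSum (suc n) + reciprocalSum (suc n)) ≡⟨ cong (½ *_) (trans (reciprocalSum-rec n) (cong (λ x → r * reciprocalSum n + x /ℕ 1) (sym (e-suc n)))) ⟩
      ½ * (r * reciprocalSum n + E)                  ≡⟨ cong (λ t → ½ * (r * t + E)) (reciprocalSum-closed n) ⟩
      ½ * (r * (p * S) + E)                          ≡⟨ expand ½ r p S E ⟩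
      ½ * r * p * S + ½ * E                          ≡⟨ cong₂ (λ u v → u * S + v * E) ½rp≡P (sym Pq≡½) ⟩
      P * S + P * q * E                              ≡⟨ collect P S q E ⟩
      P * (S + q * E)                                ∎
      where
      open ≡-Reasoning
      instance
        Q≢0 = ℕP.m^n≢0 2 (suc n)
        2Q≢0 = ℕP.m^n≢0 2 (suc (suc n))
      Q = 2 ℕ.^ suc n
      ½ = (+ 1) /ℕ 2
      r = (+ suc (suc n)) /ℕ suc n
      p = (+ suc n) /ℕ Q
      P = (+ suc (suc n)) /ℕ (2 ℕ.* Q)
      q = (+ Q) /ℕ suc (suc n)
      S = sumTo n (λ j → ((+ (2 ℕ.^ j)) /ℕ suc j) * (e j /ℕ 1))
      E = e (suc n) /ℕ 1
      ½rp≡P : ½ * r * p ≡ P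
      ½rp≡P = begin
        ½ * r * p                   ≡⟨ ℚP.*-assoc ½ r p ⟩
        ½ * (r * p)                 ≡⟨ cong (½ *_) (/ℕ-cancel (+ suc (suc n)) (suc n) Q) ⟩
        ½ * ((+ suc (suc n)) /ℕ Q)   ≡⟨ ½*[x/d]≡x/[2*d] (+ suc (suc n)) Q ⟩
        P                           ∎
      Pq≡½ : P * q ≡ ½
      Pq≡½ = begin
        P * q                ≡⟨ ℚP.*-comm P q ⟩
        q * P                ≡⟨ /ℕ-cancel (+ Q) (suc (suc n)) (2 ℕ.* Q) ⟩
        (+ Q) /ℕ (2 ℕ.* Q)    ≡⟨ m/[2*m]≡½ Q ⟩
        ½                    ∎
      expand : ∀ h r p s e → h * (r * (p * s) + e) ≡ h * r * p * s + h * e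
      expand = RingSolver.solve-∀ ℚ-ring
      collect : ∀ P s q e → P * s + P * q * e ≡ P * (s + q * e)
      collect = RingSolver.solve-∀ ℚ-ring

sgnℤ : ℤ → ℤ
sgnℤ (+ j)    = sgn j
sgnℤ -[1+ j ] = sgn (suc j)

sgnℤ[k-1]≡-sgnℤ[k] : ∀ k → sgnℤ (k ℤ.- + 1) ≡ ℤ.- sgnℤ k
sgnℤ[k-1]≡-sgnℤ[k] (+ zero)  = refl
sgnℤ[k-1]≡-sgnℤ[k] (+ suc j) = sym (ℤP.neg-involutive (sgn j))
sgnℤ[k-1]≡-sgnℤ[k] -[1+ j ]  = cong (λ i → ℤ.- sgn (suc i)) (ℕP.+-identityʳ j)

sgn[j]*sgn[j]≡1 : ∀ j → sgn j ℤ.* sgn j ≡ + 1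
sgn[j]*sgn[j]≡1 zero    = refl
sgn[j]*sgn[j]≡1 (suc j) = trans (neg*neg (sgn j)) (sgn[j]*sgn[j]≡1 j)
  where
  neg*neg : ∀ x → ℤ.- x ℤ.* ℤ.- x ≡ x ℤ.* x
  neg*neg = ℤ-Solver.solve-∀

FibonacciLike : (ℤ → ℤ) → Set
FibonacciLike g = ∀ m → g (m ℤ.+ + 2) ≡ g (m ℤ.+ + 1) ℤ.+ g m

-- The recurrence at the negative indices −(i+1), −(i+2), −(i+3), with a = u(i+1), b = u(i).
σa≡-σ[a+b]+σ[a+b+a] : ∀ σ a b → σ ℤ.* + a ≡ ℤ.- σ ℤ.* + (a ℕ.+ b) ℤ.+ ℤ.- (ℤ.- σ) ℤ.* + (a ℕ.+ b ℕ.+ a)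
σa≡-σ[a+b]+σ[a+b+a] σ a b = begin
  σ ℤ.* + a
    ≡⟨ ring σ (+ a) (+ b) ⟩
  ℤ.- σ ℤ.* (+ a ℤ.+ + b) ℤ.+ ℤ.- (ℤ.- σ) ℤ.* (+ a ℤ.+ + b ℤ.+ + a)
    ≡⟨ cong₂ (λ u v → ℤ.- σ ℤ.* u ℤ.+ ℤ.- (ℤ.- σ) ℤ.* (v ℤ.+ + a)) (ℤP.pos-+ a b) (ℤP.pos-+ a b) ⟨
  ℤ.- σ ℤ.* + (a ℕ.+ b) ℤ.+ ℤ.- (ℤ.- σ) ℤ.* + (a ℕ.+ b ℕ.+ a)
    ∎
  where
  open ≡-Reasoning
  ring : ∀ σ x y → σ ℤ.* x ≡ ℤ.- σ ℤ.* (x ℤ.+ y) ℤ.+ ℤ.- (ℤ.- σ) ℤ.* (x ℤ.+ y ℤ.+ x)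
  ring = ℤ-Solver.solve-∀

fibonacciLike-F : FibonacciLike F
fibonacciLike-F (+ k) rewrite ℕP.+-comm k 2 | ℕP.+-comm k 1 = refl
fibonacciLike-F -[1+ 0 ]           = refl
fibonacciLike-F -[1+ 1 ]           = refl
fibonacciLike-F -[1+ suc (suc i) ] = σa≡-σ[a+b]+σ[a+b+a] (sgn i) (fibℕ (suc i)) (fibℕ i)

fibonacciLike-L : FibonacciLike L
fibonacciLike-L (+ k) rewrite ℕP.+-comm k 2 | ℕP.+-comm k 1 = refl
fibonacciLike-L -[1+ 0 ]           = refl
fibonacciLike-L -[1+ 1 ]           = refl
fibonacciLike-L -[1+ suc (suc i) ] = σa≡-σ[a+b]+σ[a+b+a] (sgn (suc i)) (lucℕ (suc i)) (lucℕ i)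

module FibonacciLikeProperties (g : ℤ → ℤ) (rec : FibonacciLike g) where

  g[t+3]≡g[t+2]+g[t+1] : ∀ t → g (t ℤ.+ + 3) ≡ g (t ℤ.+ + 2) ℤ.+ g (t ℤ.+ + 1)
  g[t+3]≡g[t+2]+g[t+1] t = begin
    g (t ℤ.+ + 3)                         ≡⟨ cong g (ℤP.+-assoc t (+ 1) (+ 2)) ⟨
    g (t ℤ.+ + 1 ℤ.+ + 2)                 ≡⟨ rec (t ℤ.+ + 1) ⟩
    g (t ℤ.+ + 1 ℤ.+ + 1) ℤ.+ g (t ℤ.+ + 1) ≡⟨ cong (λ m → g m ℤ.+ g (t ℤ.+ + 1)) (ℤP.+-assoc t (+ 1) (+ 1)) ⟩
    g (t ℤ.+ + 2) ℤ.+ g (t ℤ.+ + 1)       ∎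
    where open ≡-Reasoning

  g[t]+g[t+3]≡2g[t+2] : ∀ t → g t ℤ.+ g (t ℤ.+ + 3) ≡ g (t ℤ.+ + 2) ℤ.+ g (t ℤ.+ + 2)
  g[t]+g[t+3]≡2g[t+2] t = begin
    g t ℤ.+ g (t ℤ.+ + 3)                          ≡⟨ cong (λ x → g t ℤ.+ x) (g[t+3]≡g[t+2]+g[t+1] t) ⟩
    g t ℤ.+ (g (t ℤ.+ + 2) ℤ.+ g (t ℤ.+ + 1))      ≡⟨ regroup (g t) (g (t ℤ.+ + 2)) (g (t ℤ.+ + 1)) ⟩
    g (t ℤ.+ + 2) ℤ.+ (g (t ℤ.+ + 1) ℤ.+ g t)      ≡⟨ cong (λ x → g (t ℤ.+ + 2) ℤ.+ x) (rec t) ⟨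
    g (t ℤ.+ + 2) ℤ.+ g (t ℤ.+ + 2)                ∎
    where
    open ≡-Reasoning
    regroup : ∀ x y z → x ℤ.+ (y ℤ.+ z) ≡ y ℤ.+ (z ℤ.+ x)
    regroup = ℤ-Solver.solve-∀

  g[t+3]≡2g[t+1]+g[t] : ∀ t → g (t ℤ.+ + 3) ≡ (g (t ℤ.+ + 1) ℤ.+ g (t ℤ.+ + 1)) ℤ.+ g t
  g[t+3]≡2g[t+1]+g[t] t = begin
    g (t ℤ.+ + 3)                                  ≡⟨ g[t+3]≡g[t+2]+g[t+1] t ⟩
    g (t ℤ.+ + 2) ℤ.+ g (t ℤ.+ + 1)                ≡⟨ cong (ℤ._+ g (t ℤ.+ + 1)) (rec t) ⟩
    (g (t ℤ.+ + 1) ℤ.+ g t) ℤ.+ g (t ℤ.+ + 1)      ≡⟨ regroup (g (t ℤ.+ + 1)) (g t) ⟩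
    (g (t ℤ.+ + 1) ℤ.+ g (t ℤ.+ + 1)) ℤ.+ g t      ∎
    where
    open ≡-Reasoning
    regroup : ∀ x y → (x ℤ.+ y) ℤ.+ x ≡ (x ℤ.+ x) ℤ.+ y
    regroup = ℤ-Solver.solve-∀

  module Direct (s : ℤ) where

    a : ℕ → ℤ → ℤ
    a n k = g (+ 3 ℤ.* k ℤ.+ s ℤ.- + n)

    e : ℕ → ℤ
    e j = g (s ℤ.+ + 2 ℤ.* + j ℤ.+ + 1) ℤ.+ g (s ℤ.- + j ℤ.- + 2)

    average : ∀ n k → a n (k ℤ.- + 1) ℤ.+ a n k ≡ a (suc n) k ℤ.+ a (suc n) k
    average n k = trans (cong (λ m → g t ℤ.+ g m) (shift₃ k s (+ n)))
      (trans (g[t]+g[t+3]≡2g[t+2] t) (cong (λ m → g m ℤ.+ g m) (sym (shift₂ k s (+ n)))))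
      where
      t = + 3 ℤ.* (k ℤ.- + 1) ℤ.+ s ℤ.- + n
      shift₃ : ∀ k s n → + 3 ℤ.* k ℤ.+ s ℤ.- n ≡ (+ 3 ℤ.* (k ℤ.- + 1) ℤ.+ s ℤ.- n) ℤ.+ + 3
      shift₃ = ℤ-Solver.solve-∀
      shift₂ : ∀ k s n → + 3 ℤ.* k ℤ.+ s ℤ.- (+ 1 ℤ.+ n) ≡ (+ 3 ℤ.* (k ℤ.- + 1) ℤ.+ s ℤ.- n) ℤ.+ + 2
      shift₂ = ℤ-Solver.solve-∀

    e-zero : e 0 ≡ a 0 (+ 0) ℤ.+ a 0 (+ 0)
    e-zero = begin
      g (s ℤ.+ + 2 ℤ.* + 0 ℤ.+ + 1) ℤ.+ g t   ≡⟨ ℤP.+-comm _ (g t) ⟩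
      g t ℤ.+ g (s ℤ.+ + 2 ℤ.* + 0 ℤ.+ + 1)   ≡⟨ cong (λ m → g t ℤ.+ g m) (shift₃ s) ⟩
      g t ℤ.+ g (t ℤ.+ + 3)                   ≡⟨ g[t]+g[t+3]≡2g[t+2] t ⟩
      g (t ℤ.+ + 2) ℤ.+ g (t ℤ.+ + 2)         ≡⟨ cong (λ m → g m ℤ.+ g m) (shift₂ s) ⟨
      a 0 (+ 0) ℤ.+ a 0 (+ 0)                 ∎
      where
      open ≡-Reasoning
      t = s ℤ.- + 0 ℤ.- + 2
      shift₃ : ∀ s → s ℤ.+ + 2 ℤ.* + 0 ℤ.+ + 1 ≡ (s ℤ.- + 0 ℤ.- + 2) ℤ.+ + 3
      shift₃ = ℤ-Solver.solve-∀
      shift₂ : ∀ s → + 3 ℤ.* + 0 ℤ.+ s ℤ.- + 0 ≡ (s ℤ.- + 0 ℤ.- + 2) ℤ.+ + 2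
      shift₂ = ℤ-Solver.solve-∀

    e-suc : ∀ j → e (suc j) ≡ a j (+ suc j) ℤ.+ a j ℤ.-1ℤ
    e-suc j = cong₂ (λ u v → g u ℤ.+ g v) (first-index s (+ j)) (second-index s (+ j))
      where
      first-index : ∀ s j → s ℤ.+ + 2 ℤ.* (+ 1 ℤ.+ j) ℤ.+ + 1 ≡ + 3 ℤ.* (+ 1 ℤ.+ j) ℤ.+ s ℤ.- j
      first-index = ℤ-Solver.solve-∀
      second-index : ∀ s j → s ℤ.- (+ 1 ℤ.+ j) ℤ.- + 2 ≡ + 3 ℤ.* ℤ.-1ℤ ℤ.+ s ℤ.- j
      second-index = ℤ-Solver.solve-∀

  module Alternating (s : ℤ) where

    a : ℕ → ℤ → ℤ
    a n k = sgnℤ k ℤ.* g (+ 3 ℤ.* k ℤ.+ s ℤ.- + 2 ℤ.* + n)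

    E e : ℕ → ℤ
    E j = g (s ℤ.+ + j ℤ.+ + 2) ℤ.+ sgn (suc j) ℤ.* g (s ℤ.- + 2 ℤ.* + j ℤ.- + 1)
    e j = sgn j ℤ.* E j

    average : ∀ n k → a n (k ℤ.- + 1) ℤ.+ a n k ≡ a (suc n) k ℤ.+ a (suc n) k
    average n k = begin
      sgnℤ (k ℤ.- + 1) ℤ.* g t ℤ.+ sgnℤ k ℤ.* g (+ 3 ℤ.* k ℤ.+ s ℤ.- + 2 ℤ.* + n)
        ≡⟨ cong₂ (λ σ m → σ ℤ.* g t ℤ.+ sgnℤ k ℤ.* g m) (sgnℤ[k-1]≡-sgnℤ[k] k) (shift₃ k s (+ n)) ⟩
      ℤ.- sgnℤ k ℤ.* g t ℤ.+ sgnℤ k ℤ.* g (t ℤ.+ + 3)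
        ≡⟨ cong (λ m → ℤ.- sgnℤ k ℤ.* g t ℤ.+ sgnℤ k ℤ.* m) (g[t+3]≡2g[t+1]+g[t] t) ⟩
      ℤ.- sgnℤ k ℤ.* g t ℤ.+ sgnℤ k ℤ.* ((g (t ℤ.+ + 1) ℤ.+ g (t ℤ.+ + 1)) ℤ.+ g t)
        ≡⟨ cancel (sgnℤ k) (g (t ℤ.+ + 1)) (g t) ⟩
      sgnℤ k ℤ.* g (t ℤ.+ + 1) ℤ.+ sgnℤ k ℤ.* g (t ℤ.+ + 1)
        ≡⟨ cong (λ m → sgnℤ k ℤ.* g m ℤ.+ sgnℤ k ℤ.* g m) (shift₁ k s (+ n)) ⟨
      a (suc n) k ℤ.+ a (suc n) k
        ∎
      where
      open ≡-Reasoning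
      t = + 3 ℤ.* (k ℤ.- + 1) ℤ.+ s ℤ.- + 2 ℤ.* + n
      shift₃ : ∀ k s n → + 3 ℤ.* k ℤ.+ s ℤ.- + 2 ℤ.* n ≡ (+ 3 ℤ.* (k ℤ.- + 1) ℤ.+ s ℤ.- + 2 ℤ.* n) ℤ.+ + 3
      shift₃ = ℤ-Solver.solve-∀
      shift₁ : ∀ k s n → + 3 ℤ.* k ℤ.+ s ℤ.- + 2 ℤ.* (+ 1 ℤ.+ n) ≡ (+ 3 ℤ.* (k ℤ.- + 1) ℤ.+ s ℤ.- + 2 ℤ.* n) ℤ.+ + 1
      shift₁ = ℤ-Solver.solve-∀
      cancel : ∀ σ x y → ℤ.- σ ℤ.* y ℤ.+ σ ℤ.* ((x ℤ.+ x) ℤ.+ y) ≡ σ ℤ.* x ℤ.+ σ ℤ.* x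
      cancel = ℤ-Solver.solve-∀

    e-zero : e 0 ≡ a 0 (+ 0) ℤ.+ a 0 (+ 0)
    e-zero = begin
      + 1 ℤ.* (g (s ℤ.+ + 0 ℤ.+ + 2) ℤ.+ ℤ.-1ℤ ℤ.* g t)
        ≡⟨ cong (λ m → + 1 ℤ.* (g m ℤ.+ ℤ.-1ℤ ℤ.* g t)) (shift₃ s) ⟩
      + 1 ℤ.* (g (t ℤ.+ + 3) ℤ.+ ℤ.-1ℤ ℤ.* g t)
        ≡⟨ cong (λ m → + 1 ℤ.* (m ℤ.+ ℤ.-1ℤ ℤ.* g t)) (g[t+3]≡2g[t+1]+g[t] t) ⟩
      + 1 ℤ.* (((g (t ℤ.+ + 1) ℤ.+ g (t ℤ.+ + 1)) ℤ.+ g t) ℤ.+ ℤ.-1ℤ ℤ.* g t)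
        ≡⟨ cancel (g (t ℤ.+ + 1)) (g t) ⟩
      + 1 ℤ.* g (t ℤ.+ + 1) ℤ.+ + 1 ℤ.* g (t ℤ.+ + 1)
        ≡⟨ cong (λ m → + 1 ℤ.* g m ℤ.+ + 1 ℤ.* g m) (shift₁ s) ⟨
      a 0 (+ 0) ℤ.+ a 0 (+ 0)
        ∎
      where
      open ≡-Reasoning
      t = s ℤ.- + 2 ℤ.* + 0 ℤ.- + 1
      shift₃ : ∀ s → s ℤ.+ + 0 ℤ.+ + 2 ≡ (s ℤ.- + 2 ℤ.* + 0 ℤ.- + 1) ℤ.+ + 3
      shift₃ = ℤ-Solver.solve-∀
      shift₁ : ∀ s → + 3 ℤ.* + 0 ℤ.+ s ℤ.- + 2 ℤ.* + 0 ≡ (s ℤ.- + 2 ℤ.* + 0 ℤ.- + 1) ℤ.+ + 1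
      shift₁ = ℤ-Solver.solve-∀
      cancel : ∀ x y → + 1 ℤ.* (((x ℤ.+ x) ℤ.+ y) ℤ.+ ℤ.-1ℤ ℤ.* y) ≡ + 1 ℤ.* x ℤ.+ + 1 ℤ.* x
      cancel = ℤ-Solver.solve-∀

    e-suc : ∀ j → e (suc j) ≡ a j (+ suc j) ℤ.+ a j ℤ.-1ℤ
    e-suc j = begin
      σ ℤ.* (g (s ℤ.+ + suc j ℤ.+ + 2) ℤ.+ ℤ.- σ ℤ.* g (s ℤ.- + 2 ℤ.* + suc j ℤ.- + 1))
        ≡⟨ cong₂ (λ u v → σ ℤ.* (g u ℤ.+ ℤ.- σ ℤ.* g v)) (first-index s (+ j)) (second-index s (+ j)) ⟩
      σ ℤ.* (X ℤ.+ ℤ.- σ ℤ.* Y)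
        ≡⟨ expand σ X Y ⟩
      σ ℤ.* X ℤ.+ ℤ.- (σ ℤ.* σ) ℤ.* Y
        ≡⟨ cong (λ m → σ ℤ.* X ℤ.+ ℤ.- m ℤ.* Y) (sgn[j]*sgn[j]≡1 (suc j)) ⟩
      σ ℤ.* X ℤ.+ ℤ.-1ℤ ℤ.* Y
        ∎
      where
      open ≡-Reasoning
      σ = sgn (suc j)
      X = g (+ 3 ℤ.* + suc j ℤ.+ s ℤ.- + 2 ℤ.* + j)
      Y = g (+ 3 ℤ.* ℤ.-1ℤ ℤ.+ s ℤ.- + 2 ℤ.* + j)
      first-index : ∀ s j → s ℤ.+ (+ 1 ℤ.+ j) ℤ.+ + 2 ≡ + 3 ℤ.* (+ 1 ℤ.+ j) ℤ.+ s ℤ.- + 2 ℤ.* j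
      first-index = ℤ-Solver.solve-∀
      second-index : ∀ s j → s ℤ.- + 2 ℤ.* (+ 1 ℤ.+ j) ℤ.- + 1 ≡ + 3 ℤ.* ℤ.-1ℤ ℤ.+ s ℤ.- + 2 ℤ.* j
      second-index = ℤ-Solver.solve-∀
      expand : ∀ σ x y → σ ℤ.* (x ℤ.+ ℤ.- σ ℤ.* y) ≡ σ ℤ.* x ℤ.+ ℤ.- (σ ℤ.* σ) ℤ.* y
      expand = ℤ-Solver.solve-∀

  reciprocal-binomial-sum : ∀ s n →
    sumTo n (λ j → g (+ 3 ℤ.* + j ℤ.+ s ℤ.- + n) /ℕ (n C j))
      ≡ ((+ suc n) /ℕ (2 ℕ.^ suc n)) * sumTo n (λ j → ((+ (2 ℕ.^ j)) /ℕ suc j) * ((g (s ℤ.+ + 2 ℤ.* + j ℤ.+ + 1) ℤ.+ g (s ℤ.- + j ℤ.- + 2)) /ℕ 1))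
  reciprocal-binomial-sum s = reciprocalSum-closed e e-zero e-suc
    where
    open Direct s
    open Averaging a average

  alternating-reciprocal-binomial-sum : ∀ s n →
    sumTo n (λ j → (sgn j ℤ.* g (+ 3 ℤ.* + j ℤ.+ s ℤ.- + 2 ℤ.* + n)) /ℕ (n C j))
      ≡ ((+ suc n) /ℕ (2 ℕ.^ suc n)) * sumTo n (λ j → ((sgn j ℤ.* + (2 ℕ.^ j)) /ℕ suc j) * ((g (s ℤ.+ + j ℤ.+ + 2) ℤ.+ sgn (suc j) ℤ.* g (s ℤ.- + 2 ℤ.* + j ℤ.- + 1)) /ℕ 1))
  alternating-reciprocal-binomial-sum s n = trans (reciprocalSum-closed e e-zero e-suc n)
    (cong (((+ suc n) /ℕ (2 ℕ.^ suc n)) *_) (sumTo-cong n (λ {j} _ → /ℕ-*-moveˡ (+ (2 ℕ.^ j)) (sgn j) (E j) (suc j) 1)))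
    where
    open Alternating s
    open Averaging a average

open FibonacciLikeProperties using (reciprocal-binomial-sum; alternating-reciprocal-binomial-sum)

theorem4 : (n : ℕ) (s : ℤ) →
  (sumTo n (λ j → (F (+ 3 ℤ.* + j ℤ.+ s ℤ.- + n)) /ℕ (n C j))
    ≡ ((+ ℕ.suc n) /ℕ (2 ℕ.^ ℕ.suc n)) ℚ.* sumTo n (λ j → ((+ (2 ℕ.^ j)) /ℕ ℕ.suc j) ℚ.* ((F (s ℤ.+ + 2 ℤ.* + j ℤ.+ + 1) ℤ.+ F (s ℤ.- + j ℤ.- + 2)) /ℕ 1)))
  × (sumTo n (λ j → (L (+ 3 ℤ.* + j ℤ.+ s ℤ.- + n)) /ℕ (n C j))
    ≡ ((+ ℕ.suc n) /ℕ (2 ℕ.^ ℕ.suc n)) ℚ.* sumTo n (λ j → ((+ (2 ℕ.^ j)) /ℕ ℕ.suc j) ℚ.* ((L (s ℤ.+ + 2 ℤ.* + j ℤ.+ + 1) ℤ.+ L (s ℤ.- + j ℤ.- + 2)) /ℕ 1)))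
  × (sumTo n (λ j → (sgn j ℤ.* F (+ 3 ℤ.* + j ℤ.+ s ℤ.- + 2 ℤ.* + n)) /ℕ (n C j))
    ≡ ((+ ℕ.suc n) /ℕ (2 ℕ.^ ℕ.suc n)) ℚ.* sumTo n (λ j → ((sgn j ℤ.* + (2 ℕ.^ j)) /ℕ ℕ.suc j) ℚ.* ((F (s ℤ.+ + j ℤ.+ + 2) ℤ.+ sgn (ℕ.suc j) ℤ.* F (s ℤ.- + 2 ℤ.* + j ℤ.- + 1)) /ℕ 1)))
  × (sumTo n (λ j → (sgn j ℤ.* L (+ 3 ℤ.* + j ℤ.+ s ℤ.- + 2 ℤ.* + n)) /ℕ (n C j))
    ≡ ((+ ℕ.suc n) /ℕ (2 ℕ.^ ℕ.suc n)) ℚ.* sumTo n (λ j → ((sgn j ℤ.* + (2 ℕ.^ j)) /ℕ ℕ.suc j) ℚ.* ((L (s ℤ.+ + j ℤ.+ + 2) ℤ.+ sgn (ℕ.suc j) ℤ.* L (s ℤ.- + 2 ℤ.* + j ℤ.- + 1)) /ℕ 1)))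
theorem4 n s =
    reciprocal-binomial-sum F fibonacciLike-F s n
  , reciprocal-binomial-sum L fibonacciLike-L s n
  , alternating-reciprocal-binomial-sum F fibonacciLike-F s n
  , alternating-reciprocal-binomial-sum L fibonacciLike-L s n
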